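{- In the maximum-weight online bipartite left-perfect matching problem with general nonnegative weights under vertex arrivals with hard budget $k=4$ on the number of reassignments (defined in the context), the most-profitable-augmenting-path algorithm described in the context is $\frac{1}{2}$-competitive.
   Context: Problem. Let $G=(L\cup R,E)$ be a complete bipartite graph with $|L|\le|R|$ and nonnegative edge weights $w:E\to\mathbb{Q}_{\ge 0}$ (no triangle inequality or other metric assumption). The algorithm initially knows $R$ and $k=4$. Over $|L|$ timesteps the vertices of $L$ arrive one at a time, each revealed together with the weights of all its incident edges. At the end of each timestep the algorithm must output a left-perfect matching of the current graph (a matching covering every arrived vertex of $L$), obtained from its previous matching (initially $\emptyset$) by at most $k$ (re)assignments, where the number of (re)assignments needed to go from matching $M_1$ to matching $M_2$ is the number of vertices incident to at least one edge of $M_1\triangle M_2$. Once a vertex is matched it must remain matched. An algorithm is $\rho$-competitive if there is a constant $c\ge0$ such that on every instance the final matching has weight at least $\rho\cdot\mathsf{OPT}-c$, where $\mathsf{OPT}$ is the maximum weight of a left-perfect matching in $G$. Algorithm. An augmenting path with respect to a matching $M$ is a path whose two endpoints are distinct vertices not covered by $M$ and whose edges alternate between non-$M$ and $M$ edges. When vertex $u$ arrives, among all augmenting paths (with respect to the current matching $M$, in the current graph) containing $u$ and having at most $k$ vertices, the algorithm picks one, $P$, maximizing the weight gain $\sum_{e\in M\triangle P}w(e)-\sum_{e\in M}w(e)$, and replaces $M$ by $M\triangle P$ (doing nothing if no such path exists). -}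

module Defs where

open import Data.Nat using (ℕ; zero; suc; _<_; _≤_)
open import Data.Fin using (Fin; toℕ; fromℕ<) renaming (zero to fzero; suc to fsuc)
open import Data.Unit using (⊤)
open import Data.Empty using (⊥)
open import Data.Fin.Properties using (_≟_)
open import Data.Bool using (Bool; true; false; _∧_; _∨_; _xor_; if_then_else_)
open import Data.Sum using (_⊎_; inj₁; inj₂)
open import Data.Product using (_×_; _,_; ∃; Σ)
open import Data.Maybe using (just)
open import Data.List using (List; []; _∷_; length; head; last)
open import Data.Bool.ListAction using (any)
open import Data.List.Relation.Unary.All using (All)
open import Data.List.Relation.Unary.Unique.Propositional using (Unique)
open import Data.List.Membership.Propositional using (_∈_)
open import Data.Rational using (ℚ; 0ℚ; _+_; _-_)
import Data.Rational as Q
open import Relation.Nullary using (¬_)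
open import Relation.Nullary.Decidable using (⌊_⌋)
open import Relation.Binary.PropositionalEquality using (_≡_; _≢_)

-- Vertices of the complete bipartite graph G = (L ∪ R, E), with L = Fin n
-- (indexed in arrival order) and R = Fin m.
Vertex : ℕ → ℕ → Set
Vertex n m = Fin n ⊎ Fin m

-- An edge set of G (every pair (i , j) ∈ L × R is an edge of G).
EdgeSet : ℕ → ℕ → Set
EdgeSet n m = Fin n → Fin m → Bool

Weights : ℕ → ℕ → Set
Weights n m = Fin n → Fin m → ℚ

emptyM : ∀ {n m} → EdgeSet n m
emptyM _ _ = false

sumFin : (k : ℕ) → (Fin k → ℚ) → ℚ
sumFin zero    f = 0ℚ
sumFin (suc k) f = f fzero + sumFin k (λ i → f (fsuc i))

weight : ∀ {n m} → Weights n m → EdgeSet n m → ℚ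
weight {n} {m} w M = sumFin n (λ i → sumFin m (λ j → if M i j then w i j else 0ℚ))

IsMatching : ∀ {n m} → EdgeSet n m → Set
IsMatching {n} {m} M =
  (∀ i j j' → M i j ≡ true → M i j' ≡ true → j ≡ j') ×
  (∀ i i' j → M i j ≡ true → M i' j ≡ true → i ≡ i')

IsLeftPerfectMatching : ∀ {n m} → EdgeSet n m → Set
IsLeftPerfectMatching {n} {m} M = IsMatching M × (∀ i → ∃ λ j → M i j ≡ true)

Covered : ∀ {n m} → EdgeSet n m → Vertex n m → Set
Covered {n} {m} M (inj₁ i) = ∃ λ (j : Fin m) → M i j ≡ true
Covered {n} {m} M (inj₂ j) = ∃ λ (i : Fin n) → M i j ≡ true

pairs : ∀ {A : Set} → List A → List (A × A)
pairs (x ∷ y ∷ xs) = (x , y) ∷ pairs (y ∷ xs)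
pairs _            = []

triples : ∀ {A : Set} → List A → List (A × A × A)
triples (x ∷ y ∷ z ∷ xs) = (x , y , z) ∷ triples (y ∷ z ∷ xs)
triples _                = []

IsEdge : ∀ {n m} → Vertex n m × Vertex n m → Set
IsEdge (inj₁ _ , inj₂ _) = ⊤
IsEdge (inj₂ _ , inj₁ _) = ⊤
IsEdge (inj₁ _ , inj₁ _) = ⊥
IsEdge (inj₂ _ , inj₂ _) = ⊥

inM : ∀ {n m} → EdgeSet n m → Vertex n m × Vertex n m → Bool
inM M (inj₁ i , inj₂ j) = M i j
inM M (inj₂ j , inj₁ i) = M i j
inM M _                 = false

isEdgeIJ : ∀ {n m} → Fin n → Fin m → Vertex n m × Vertex n m → Bool
isEdgeIJ i j (inj₁ a , inj₂ b) = ⌊ i ≟ a ⌋ ∧ ⌊ j ≟ b ⌋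
isEdgeIJ i j (inj₂ b , inj₁ a) = ⌊ i ≟ a ⌋ ∧ ⌊ j ≟ b ⌋
isEdgeIJ i j _                 = false

pathEdges : ∀ {n m} → List (Vertex n m) → EdgeSet n m
pathEdges p i j = any (isEdgeIJ i j) (pairs p)

_△_ : ∀ {n m} → EdgeSet n m → EdgeSet n m → EdgeSet n m
(M △ E) i j = M i j xor E i j

-- vertex belongs to the current graph after t+1 arrivals (L-vertices 0..t)
InCurrentGraph : ∀ {n m} → ℕ → Vertex n m → Set
InCurrentGraph t (inj₁ i) = toℕ i ≤ t
InCurrentGraph t (inj₂ _) = ⊤

-- P is an augmenting path w.r.t. M in the current graph (L-vertices 0..t,
-- t being the index of the vertex u that just arrived), containing u and
-- having at most k vertices.
record AugPath {n m} (k t : ℕ) (t<n : t < n) (M : EdgeSet n m)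
               (P : List (Vertex n m)) : Set where
  field
    inGraph     : All (InCurrentGraph t) P
    distinct    : Unique P
    atLeastTwo  : 2 ≤ length P
    edges       : All IsEdge (pairs P)
    alternating : All (λ { (a , b , c) → inM M (a , b) ≢ inM M (b , c) }) (triples P)
    endpointsFree : ∀ x → (head P ≡ just x ⊎ last P ≡ just x) → ¬ Covered M x
    containsU   : inj₁ (fromℕ< t<n) ∈ P
    short       : length P ≤ k

gain : ∀ {n m} → Weights n m → EdgeSet n m → List (Vertex n m) → ℚ
gain w M P = weight w (M △ pathEdges P) - weight w M

-- Runs of the algorithm (any tie-breaking): Run k w t M means that M is a
-- possible matching held by the algorithm after the first t arrivals.
data Run {n m} (k : ℕ) (w : Weights n m) : ℕ → EdgeSet n m → Set where
  start   : Run k w 0 emptyM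
  augment : ∀ {t M} (t<n : t < n) → Run k w t M →
            (P : List (Vertex n m)) → AugPath k t t<n M P →
            (∀ Q → AugPath k t t<n M Q → gain w M Q Q.≤ gain w M P) →
            Run k w (suc t) (M △ pathEdges P)
  idle    : ∀ {t M} (t<n : t < n) → Run k w t M →
            (∀ Q → ¬ AugPath k t t<n M Q) →
            Run k w (suc t) M

-- Dual fitting.  Let N be a left-perfect matching and ν i the partner of i in N.  Along the run
-- we maintain a dual H on R with H j ≤ 0 for every free j, and H j ≤ w i j and
-- H j ≤ w i j - w i j' for every edge ij of the current matching M and every free j'.  When u
-- arrives, the paths u–j' and u–j–i–j' (ij ∈ M, j' free) are candidates, so the chosen gain g is
-- at least w u j' and w u j - w i j + w i j'; this is exactly what keeps the constraints valid
-- after setting H (ν u) := w u (ν u) - g.  Hence the arrival of u is charged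
-- w u (ν u) = g + H (ν u), and w N ≤ w M + Σ_i H (ν i).  Each right vertex j contributes at most
-- max (H j) 0 to the last sum, which the M-edge at j (if any) pays for, so w N ≤ 2 w M.
-- Since n ≤ m a free right vertex always exists, so the algorithm never stays idle.

module Submission where

open import Defs

module RationalArithmetic where

  open import Data.List using ([]; _∷_)
  open import Data.Rational using (ℚ; 0ℚ; ½; _+_; _-_; -_; _*_; _≤_)
  import Data.Rational.Properties as ℚ
  open import Relation.Binary.PropositionalEquality
  open import Relation.Nullary.Decidable using (dec⇒maybe)
  open import Tactic.RingSolver using (solve)
  open import Tactic.RingSolver.Core.AlmostCommutativeRing using (AlmostCommutativeRing; fromCommutativeRing)

  ℚ-ring : AlmostCommutativeRing _ _
  ℚ-ring = fromCommutativeRing ℚ.+-*-commutativeRing (λ x → dec⇒maybe (0ℚ ℚ.≟ x))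

  ≤-by-slack : ∀ {a b c d} → b - a ≡ d - c → a ≤ b → c ≤ d
  ≤-by-slack {a} {b} {c} {d} same a≤b = subst₂ _≤_ a+[c-a]≡c b+[c-a]≡d (ℚ.+-monoˡ-≤ (c - a) a≤b)
    where
    open ≡-Reasoning
    a+[c-a]≡c : a + (c - a) ≡ c
    a+[c-a]≡c = solve (a ∷ c ∷ []) ℚ-ring
    b+[c-a]≡d : b + (c - a) ≡ d
    b+[c-a]≡d = begin
      b + (c - a) ≡⟨ solve (a ∷ b ∷ c ∷ []) ℚ-ring ⟩
      c + (b - a) ≡⟨ cong (c +_) same ⟩
      c + (d - c) ≡⟨ solve (c ∷ d ∷ []) ℚ-ring ⟩
      d           ∎

  p≤q⇒p-q≤0 : ∀ {p q} → p ≤ q → p - q ≤ 0ℚ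
  p≤q⇒p-q≤0 {p} {q} p≤q = subst (p - q ≤_) (ℚ.+-inverseʳ q) (ℚ.+-monoˡ-≤ (- q) p≤q)

  p≤q⇒0≤q-p : ∀ {p q} → p ≤ q → 0ℚ ≤ q - p
  p≤q⇒0≤q-p {p} {q} p≤q = subst (_≤ q - p) (ℚ.+-inverseʳ p) (ℚ.+-monoˡ-≤ (- p) p≤q)

  0≤q⇒p-q≤p : ∀ {p q} → 0ℚ ≤ q → p - q ≤ p
  0≤q⇒p-q≤p {p} {q} 0≤q = subst (p - q ≤_) (ℚ.+-identityʳ p) (ℚ.+-monoʳ-≤ p (ℚ.neg-antimono-≤ 0≤q))

  r≤q⇒p-q≤p-r : ∀ {p q r} → r ≤ q → p - q ≤ p - r
  r≤q⇒p-q≤p-r {p} {q} {r} = ≤-by-slack (solve (p ∷ q ∷ r ∷ []) ℚ-ring)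

  p-q+r≤s⇒p-s≤q-r : ∀ {p q r s} → p - q + r ≤ s → p - s ≤ q - r
  p-q+r≤s⇒p-s≤q-r {p} {q} {r} {s} = ≤-by-slack (solve (p ∷ q ∷ r ∷ s ∷ []) ℚ-ring)

  p-q+r≤p-q+s⇒r≤s : ∀ {p q r s} → p - q + r ≤ p - q + s → r ≤ s
  p-q+r≤p-q+s⇒r≤s {p} {q} {r} {s} = ≤-by-slack (solve (p ∷ q ∷ r ∷ s ∷ []) ℚ-ring)

  p+q-p≡q : ∀ p q → p + q - p ≡ q
  p+q-p≡q p q = solve (p ∷ q ∷ []) ℚ-ring

  q≡p+[q-p] : ∀ p q → q ≡ p + (q - p)
  q≡p+[q-p] p q = solve (p ∷ q ∷ []) ℚ-ring

  p+[-q+r]≡p-q+r : ∀ p q r → p + (- q + r) ≡ p - q + r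
  p+[-q+r]≡p-q+r p q r = solve (p ∷ q ∷ r ∷ []) ℚ-ring

  q-r≡p-[p-q+r] : ∀ p q r → q - r ≡ p - (p - q + r)
  q-r≡p-[p-q+r] p q r = solve (p ∷ q ∷ r ∷ []) ℚ-ring

  p+q+[r+[s-q]]≡p+r+s : ∀ p q r s → p + q + (r + (s - q)) ≡ p + r + s
  p+q+[r+[s-q]]≡p+r+s p q r s = solve (p ∷ q ∷ r ∷ s ∷ []) ℚ-ring

  p≤q+q⇒½*p-0≤q : ∀ {p q} → p ≤ q + q → ½ * p - 0ℚ ≤ q
  p≤q+q⇒½*p-0≤q {p} {q} p≤2q = subst₂ _≤_ (sym (ℚ.+-identityʳ (½ * p))) ½*[q+q]≡q (ℚ.*-monoˡ-≤-nonNeg ½ p≤2q)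
    where
    open ≡-Reasoning
    ½*[q+q]≡q : ½ * (q + q) ≡ q
    ½*[q+q]≡q = begin
      ½ * (q + q)    ≡⟨ ℚ.*-distribˡ-+ ½ q q ⟩
      ½ * q + ½ * q  ≡⟨ ℚ.*-distribʳ-+ q ½ ½ ⟨
      (½ + ½) * q    ≡⟨ ℚ.*-identityˡ q ⟩
      q              ∎

module DualFitting where

  open RationalArithmetic

  import Algebra.Properties.CommutativeMonoid.Sum as CommutativeMonoidSum
  open import Data.Bool using (Bool; true; false; _∧_; _∨_; _xor_; if_then_else_)
  import Data.Bool.Properties as Bool
  open import Data.Empty using (⊥-elim)
  open import Data.Fin using (Fin; toℕ; fromℕ<) renaming (zero to fzero; suc to fsuc)
  open import Data.Fin.Properties using (_≟_; 0≢1+n; suc-injective; any?; all?; pigeonhole; toℕ<n; toℕ-fromℕ<; toℕ-injective)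
  open import Data.List using (List; []; _∷_; reverse; length)
  open import Data.List.Membership.Propositional using (_∈_; _∉_)
  open import Data.List.Relation.Unary.All as All using (All; []; _∷_)
  open import Data.List.Relation.Unary.AllPairs using ([]; _∷_)
  open import Data.List.Relation.Unary.Any using (here; there)
  import Data.List.Relation.Unary.Any.Properties as Any
  open import Data.Nat as ℕ using (ℕ; zero; suc; s≤s; z≤n)
  import Data.Nat.Properties as ℕ
  open import Data.Product using (_×_; _,_; ∃; proj₁; proj₂)
  open import Data.Product.Properties using (≡-dec)
  open import Data.Rational using (ℚ; 0ℚ; _+_; _-_; -_; _≤_)
  import Data.Rational.Properties as ℚ
  open import Data.Sum using (_⊎_; inj₁; inj₂)
  open import Data.Unit using (tt)
  open import Data.Vec.Functional using (updateAt)
  open import Data.Vec.Functional.Properties using (updateAt-updates; updateAt-minimal)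
  open import Function using (_∘_; const)
  open import Relation.Binary.PropositionalEquality
  open import Relation.Binary.Definitions using (tri<; tri≈; tri>)
  open import Relation.Nullary using (¬_; Dec; yes; no)
  open import Relation.Nullary.Decidable using (⌊_⌋; dec-true; dec-false; isYes≗does)

  true≢false : true ≢ false
  true≢false ()

  ⌊⌋-true : ∀ {A : Set} (a? : Dec A) → A → ⌊ a? ⌋ ≡ true
  ⌊⌋-true a? a = trans (isYes≗does a?) (dec-true a? a)

  ⌊⌋-false : ∀ {A : Set} (a? : Dec A) → ¬ A → ⌊ a? ⌋ ≡ false
  ⌊⌋-false a? ¬a = trans (isYes≗does a?) (dec-false a? ¬a)

  ≟-refl : ∀ {k} (a : Fin k) → ⌊ a ≟ a ⌋ ≡ true
  ≟-refl a = ⌊⌋-true (a ≟ a) refl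

  ≟-sound : ∀ {k} {i a : Fin k} → ⌊ i ≟ a ⌋ ≡ true → i ≡ a
  ≟-sound {i = i} {a} eq with i ≟ a | eq
  ... | yes i≡a | _ = i≡a
  ... | no _    | ()

  -- Finite sums

  module Σ = CommutativeMonoidSum ℚ.+-0-commutativeMonoid

  sumFin≡sum : ∀ k (f : Fin k → ℚ) → sumFin k f ≡ Σ.sum f
  sumFin≡sum zero    f = refl
  sumFin≡sum (suc k) f = cong (f fzero +_) (sumFin≡sum k (f ∘ fsuc))

  sumFin-cong : ∀ k {f g : Fin k → ℚ} → (∀ i → f i ≡ g i) → sumFin k f ≡ sumFin k g
  sumFin-cong zero    f≗g = refl
  sumFin-cong (suc k) f≗g = cong₂ _+_ (f≗g fzero) (sumFin-cong k (f≗g ∘ fsuc))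

  sumFin-mono : ∀ k {f g : Fin k → ℚ} → (∀ i → f i ≤ g i) → sumFin k f ≤ sumFin k g
  sumFin-mono zero    f≤g = ℚ.≤-refl
  sumFin-mono (suc k) f≤g = ℚ.+-mono-≤ (f≤g fzero) (sumFin-mono k (f≤g ∘ fsuc))

  sumFin-0 : ∀ k {f : Fin k → ℚ} → (∀ i → f i ≡ 0ℚ) → sumFin k f ≡ 0ℚ
  sumFin-0 k f≗0 = trans (sumFin-cong k f≗0) (trans (sumFin≡sum k _) (Σ.sum-replicate-zero k))

  sumFin-nonneg : ∀ k {f : Fin k → ℚ} → (∀ i → 0ℚ ≤ f i) → 0ℚ ≤ sumFin k f
  sumFin-nonneg k {f} 0≤f = subst (_≤ sumFin k f) (sumFin-0 k (λ _ → refl)) (sumFin-mono k {const 0ℚ} 0≤f)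

  sumFin-+ : ∀ k (f g : Fin k → ℚ) → sumFin k (λ i → f i + g i) ≡ sumFin k f + sumFin k g
  sumFin-+ k f g = begin
    sumFin k (λ i → f i + g i) ≡⟨ sumFin≡sum k _ ⟩
    Σ.sum (λ i → f i + g i)    ≡⟨ Σ.∑-distrib-+ f g ⟩
    Σ.sum f + Σ.sum g          ≡⟨ cong₂ _+_ (sumFin≡sum k f) (sumFin≡sum k g) ⟨
    sumFin k f + sumFin k g    ∎
    where open ≡-Reasoning

  sumFin-comm : ∀ k l (f : Fin k → Fin l → ℚ) →
    sumFin k (λ i → sumFin l (f i)) ≡ sumFin l (λ j → sumFin k (λ i → f i j))
  sumFin-comm k l f = begin
    sumFin k (λ i → sumFin l (f i))         ≡⟨ sumFin²≡sum² k l f ⟩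
    Σ.sum (λ i → Σ.sum (f i))               ≡⟨ Σ.∑-comm f ⟩
    Σ.sum (λ j → Σ.sum (λ i → f i j))       ≡⟨ sumFin²≡sum² l k (λ j i → f i j) ⟨
    sumFin l (λ j → sumFin k (λ i → f i j)) ∎
    where
    open ≡-Reasoning
    sumFin²≡sum² : ∀ k l (f : Fin k → Fin l → ℚ) → sumFin k (λ i → sumFin l (f i)) ≡ Σ.sum (λ i → Σ.sum (f i))
    sumFin²≡sum² k l f = trans (sumFin-cong k (λ i → sumFin≡sum l (f i))) (sumFin≡sum k _)

  sumFin-indicator : ∀ k (P : Fin k → Bool) (f : Fin k → ℚ) {a} → P a ≡ true → (∀ i → P i ≡ true → i ≡ a) →
    sumFin k (λ i → if P i then f i else 0ℚ) ≡ f a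
  sumFin-indicator (suc k) P f {fzero} Pa only-a rewrite Pa =
    trans (cong (f fzero +_) (sumFin-0 k others)) (ℚ.+-identityʳ (f fzero))
    where
    others : ∀ i → (if P (fsuc i) then f (fsuc i) else 0ℚ) ≡ 0ℚ
    others i with P (fsuc i) in Pi
    ... | true  = ⊥-elim (0≢1+n (sym (only-a (fsuc i) Pi)))
    ... | false = refl
  sumFin-indicator (suc k) P f {fsuc a} Pa only-a with P fzero in P0
  ... | true  = ⊥-elim (0≢1+n (only-a fzero P0))
  ... | false = trans (ℚ.+-identityˡ _)
    (sumFin-indicator k (P ∘ fsuc) (f ∘ fsuc) Pa (λ i Pi → suc-injective (only-a (fsuc i) Pi)))

  sumFin-point : ∀ k (f : Fin k → ℚ) a → sumFin k (λ i → if ⌊ i ≟ a ⌋ then f i else 0ℚ) ≡ f a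
  sumFin-point k f a = sumFin-indicator k (λ i → ⌊ i ≟ a ⌋) f (≟-refl a) (λ _ → ≟-sound)

  sumFin-atMostOnce-≤ : ∀ k (P : Fin k → Bool) {x y} → (∀ i i' → P i ≡ true → P i' ≡ true → i ≡ i') →
    x ≤ y → 0ℚ ≤ y → sumFin k (λ i → if P i then x else 0ℚ) ≤ y
  sumFin-atMostOnce-≤ k P {x} {y} unique x≤y 0≤y with any? (λ i → P i Bool.≟ true)
  ... | yes (a , Pa) = subst (_≤ y) (sym (sumFin-indicator k P (const x) Pa (λ i Pi → unique i a Pi Pa))) x≤y
  ... | no none = subst (_≤ y) (sym (sumFin-0 k absent)) 0≤y
    where
    absent : ∀ i → (if P i then x else 0ℚ) ≡ 0ℚ
    absent i rewrite Bool.¬-not {P i} (λ Pi → none (i , Pi)) = refl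

  arrivedSum : ∀ {n} → ℕ → (Fin n → ℚ) → ℚ
  arrivedSum {n} t f = sumFin n λ i → if ⌊ toℕ i ℕ.<? t ⌋ then f i else 0ℚ

  arrivedSum-zero : ∀ {n} (f : Fin n → ℚ) → arrivedSum 0 f ≡ 0ℚ
  arrivedSum-zero {n} f = sumFin-0 n λ i → cong (λ b → if b then f i else 0ℚ) (⌊⌋-false (toℕ i ℕ.<? 0) λ ())

  arrivedSum-all : ∀ {n} (f : Fin n → ℚ) → arrivedSum n f ≡ sumFin n f
  arrivedSum-all {n} f = sumFin-cong n λ i → cong (λ b → if b then f i else 0ℚ) (⌊⌋-true (toℕ i ℕ.<? n) (toℕ<n i))

  arrivedSum-cong : ∀ {n} t {f g : Fin n → ℚ} → (∀ i → toℕ i ℕ.< t → f i ≡ g i) → arrivedSum t f ≡ arrivedSum t g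
  arrivedSum-cong {n} t {f} {g} f≗g = sumFin-cong n pointwise
    where
    pointwise : ∀ i → (if ⌊ toℕ i ℕ.<? t ⌋ then f i else 0ℚ) ≡ (if ⌊ toℕ i ℕ.<? t ⌋ then g i else 0ℚ)
    pointwise i with toℕ i ℕ.<? t
    ... | yes i<t = f≗g i i<t
    ... | no _    = refl

  arrivedSum-suc : ∀ {n t} (t<n : t ℕ.< n) (f : Fin n → ℚ) → arrivedSum (suc t) f ≡ arrivedSum t f + f (fromℕ< t<n)
  arrivedSum-suc {n} {t} t<n f = begin
      arrivedSum (suc t) f
    ≡⟨ sumFin-cong n split ⟩
      sumFin n (λ i → (if ⌊ toℕ i ℕ.<? t ⌋ then f i else 0ℚ) + (if ⌊ i ≟ u ⌋ then f i else 0ℚ))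
    ≡⟨ sumFin-+ n _ _ ⟩
      arrivedSum t f + sumFin n (λ i → if ⌊ i ≟ u ⌋ then f i else 0ℚ)
    ≡⟨ cong (arrivedSum t f +_) (sumFin-point n f u) ⟩
      arrivedSum t f + f u ∎
    where
    open ≡-Reasoning
    u = fromℕ< t<n
    toℕ-u : toℕ u ≡ t
    toℕ-u = toℕ-fromℕ< t<n
    split : ∀ i → (if ⌊ toℕ i ℕ.<? suc t ⌋ then f i else 0ℚ) ≡
                  (if ⌊ toℕ i ℕ.<? t ⌋ then f i else 0ℚ) + (if ⌊ i ≟ u ⌋ then f i else 0ℚ)
    split i with ℕ.<-cmp (toℕ i) t
    ... | tri< i<t _ _
      rewrite ⌊⌋-true (toℕ i ℕ.<? suc t) (ℕ.m<n⇒m<1+n i<t) | ⌊⌋-true (toℕ i ℕ.<? t) i<t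
            | ⌊⌋-false (i ≟ u) (λ { refl → ℕ.<-irrefl toℕ-u i<t }) = sym (ℚ.+-identityʳ (f i))
    ... | tri> _ _ t<i
      rewrite ⌊⌋-false (toℕ i ℕ.<? suc t) (ℕ.<⇒≱ t<i ∘ ℕ.m<1+n⇒m≤n) | ⌊⌋-false (toℕ i ℕ.<? t) (ℕ.<⇒≯ t<i)
            | ⌊⌋-false (i ≟ u) (λ { refl → ℕ.<-irrefl (sym toℕ-u) t<i }) = sym (ℚ.+-identityˡ 0ℚ)
    ... | tri≈ _ i≡t _ with toℕ-injective (trans i≡t (sym toℕ-u))
    ...   | refl
      rewrite ⌊⌋-true (toℕ u ℕ.<? suc t) (subst (ℕ._< suc t) (sym toℕ-u) (ℕ.n<1+n t))
            | ⌊⌋-false (toℕ u ℕ.<? t) (ℕ.<-irrefl toℕ-u) | ≟-refl u = sym (ℚ.+-identityˡ (f u))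

  -- Edge sets and the weight of a symmetric difference

  module _ {n m : ℕ} where

    _≐_ : EdgeSet n m → EdgeSet n m → Set
    A ≐ B = ∀ i j → A i j ≡ B i j

    edge : Fin n → Fin m → EdgeSet n m
    edge a b i j = ⌊ i ≟ a ⌋ ∧ ⌊ j ≟ b ⌋

    edgesOf : List (Fin n × Fin m) → EdgeSet n m
    edgesOf []             i j = false
    edgesOf ((a , b) ∷ es) i j = edge a b i j ∨ edgesOf es i j

    edge-true : ∀ {a b i j} → edge a b i j ≡ true → (i , j) ≡ (a , b)
    edge-true {a} {b} {i} {j} eq with i ≟ a | j ≟ b | eq
    ... | yes refl | yes refl | _  = refl
    ... | yes _    | no _     | ()
    ... | no _     | _        | ()

    edge-self : ∀ a b → edge a b a b ≡ true
    edge-self a b rewrite ≟-refl a | ≟-refl b = refl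

    edgesOf-∈ : ∀ es {i j} → edgesOf es i j ≡ true → (i , j) ∈ es
    edgesOf-∈ ((a , b) ∷ es) {i} {j} eq with edge a b i j in e
    ... | true  = here (edge-true {a} {b} {i} {j} e)
    ... | false = there (edgesOf-∈ es eq)

    ∈-edgesOf : ∀ {es i j} → (i , j) ∈ es → edgesOf es i j ≡ true
    ∈-edgesOf {(i , j) ∷ es} (here refl) rewrite edge-self i j = refl
    ∈-edgesOf {(a , b) ∷ es} (there ij∈es) rewrite ∈-edgesOf ij∈es = Bool.∨-zeroʳ _

    ∉-edgesOf : ∀ {es i j} → (i , j) ∉ es → edgesOf es i j ≡ false
    ∉-edgesOf {es} {i} {j} ij∉es with edgesOf es i j in e
    ... | true  = ⊥-elim (ij∉es (edgesOf-∈ es e))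
    ... | false = refl

    edgesOf-cong : ∀ {es es'} → (∀ {e} → e ∈ es → e ∈ es') → (∀ {e} → e ∈ es' → e ∈ es) → edgesOf es ≐ edgesOf es'
    edgesOf-cong {es} {es'} ⊆ ⊇ i j with edgesOf es i j in e | edgesOf es' i j in e'
    ... | true  | true  = refl
    ... | false | false = refl
    ... | true  | false = ⊥-elim (true≢false (trans (sym (∈-edgesOf (⊆ (edgesOf-∈ es e)))) e'))
    ... | false | true  = ⊥-elim (true≢false (trans (sym (∈-edgesOf (⊇ (edgesOf-∈ es' e')))) e))

    edgesOf-reverse : ∀ es → edgesOf (reverse es) ≐ edgesOf es
    edgesOf-reverse es = edgesOf-cong {reverse es} {es} Any.reverse⁻ Any.reverse⁺

    module Toggle {M E : EdgeSet n m} {es} (E≐es : E ≐ edgesOf es) where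

      toggled : ∀ {i j} → (M △ E) i j ≡ true → (M i j ≡ true × (i , j) ∉ es) ⊎ (M i j ≡ false × (i , j) ∈ es)
      toggled {i} {j} eq with M i j | E i j in e | eq
      ... | true  | false | _  = inj₁ (refl , λ ij∈es → true≢false (trans (sym (∈-edgesOf ij∈es)) (trans (sym (E≐es i j)) e)))
      ... | false | true  | _  = inj₂ (refl , edgesOf-∈ es (trans (sym (E≐es i j)) e))
      ... | true  | true  | ()
      ... | false | false | ()

      kept : ∀ {i j} → M i j ≡ true → (i , j) ∉ es → (M △ E) i j ≡ true
      kept {i} {j} Mij ij∉es rewrite Mij | E≐es i j | ∉-edgesOf ij∉es = refl

      added : ∀ {i j} → M i j ≡ false → (i , j) ∈ es → (M △ E) i j ≡ true
      added {i} {j} Mij ij∈es rewrite Mij | E≐es i j | ∈-edgesOf ij∈es = refl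

    sumOver : EdgeSet n m → (Fin n → Fin m → ℚ) → ℚ
    sumOver E F = sumFin n λ i → sumFin m λ j → if E i j then F i j else 0ℚ

    sumOver-cong : ∀ {E E'} F → E ≐ E' → sumOver E F ≡ sumOver E' F
    sumOver-cong F E≐E' = sumFin-cong n λ i → sumFin-cong m λ j → cong (λ b → if b then F i j else 0ℚ) (E≐E' i j)

    sumOver-[] : ∀ F → sumOver (edgesOf []) F ≡ 0ℚ
    sumOver-[] F = sumFin-0 n λ i → sumFin-0 m λ j → refl

    sumOver-edge : ∀ F a b → sumOver (edge a b) F ≡ F a b
    sumOver-edge F a b = trans (sumFin-cong n row) (sumFin-point n (λ i → F i b) a)
      where
      row : ∀ i → sumFin m (λ j → if edge a b i j then F i j else 0ℚ) ≡ (if ⌊ i ≟ a ⌋ then F i b else 0ℚ)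
      row i with ⌊ i ≟ a ⌋
      ... | true  = sumFin-point m (F i) b
      ... | false = sumFin-0 m λ _ → refl

    if-∨ : ∀ {x y} (v : ℚ) → x ∧ y ≡ false → (if x ∨ y then v else 0ℚ) ≡ (if x then v else 0ℚ) + (if y then v else 0ℚ)
    if-∨ {true}  {false} v _ = sym (ℚ.+-identityʳ v)
    if-∨ {false} {true}  v _ = sym (ℚ.+-identityˡ v)
    if-∨ {false} {false} v _ = sym (ℚ.+-identityˡ 0ℚ)

    sumOver-∷ : ∀ F {a b es} → (a , b) ∉ es → sumOver (edgesOf ((a , b) ∷ es)) F ≡ F a b + sumOver (edgesOf es) F
    sumOver-∷ F {a} {b} {es} ab∉es = begin
      sumOver (edgesOf ((a , b) ∷ es)) F
        ≡⟨ sumFin-cong n (λ i → trans (sumFin-cong m (λ j → if-∨ {edge a b i j} (F i j) (disjoint i j))) (sumFin-+ m (single i) (rest i))) ⟩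
      sumFin n (λ i → sumFin m (single i) + sumFin m (rest i))
        ≡⟨ sumFin-+ n _ _ ⟩
      sumOver (edge a b) F + sumOver (edgesOf es) F
        ≡⟨ cong (_+ sumOver (edgesOf es) F) (sumOver-edge F a b) ⟩
      F a b + sumOver (edgesOf es) F ∎
      where
      open ≡-Reasoning
      single rest : Fin n → Fin m → ℚ
      single i j = if edge a b i j then F i j else 0ℚ
      rest i j = if edgesOf es i j then F i j else 0ℚ
      disjoint : ∀ i j → edge a b i j ∧ edgesOf es i j ≡ false
      disjoint i j with edge a b i j in e
      ... | false = refl
      ... | true with edge-true {a} {b} {i} {j} e
      ...   | refl = ∉-edgesOf ab∉es

    toggleGain : Weights n m → EdgeSet n m → Fin n → Fin m → ℚ
    toggleGain w M i j = if M i j then - w i j else w i j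

    weight-△ : ∀ w M E → weight w (M △ E) ≡ weight w M + sumOver E (toggleGain w M)
    weight-△ w M E = trans
      (sumFin-cong n λ i → trans (sumFin-cong m λ j → if-xor (M i j) (E i j) (w i j)) (sumFin-+ m _ _))
      (sumFin-+ n _ _)
      where
      if-xor : ∀ a e (x : ℚ) → (if a xor e then x else 0ℚ) ≡ (if a then x else 0ℚ) + (if e then (if a then - x else x) else 0ℚ)
      if-xor true  true  x = sym (ℚ.+-inverseʳ x)
      if-xor true  false x = sym (ℚ.+-identityʳ x)
      if-xor false true  x = sym (ℚ.+-identityˡ x)
      if-xor false false x = sym (ℚ.+-identityˡ 0ℚ)

    gain≡sumOver : ∀ w M P → gain w M P ≡ sumOver (pathEdges P) (toggleGain w M)
    gain≡sumOver w M P = trans (cong (_- weight w M) (weight-△ w M (pathEdges P))) (p+q-p≡q (weight w M) _)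

  -- Matchings of the arrived vertices and short augmenting paths

  module _ {n m : ℕ} where

    Free : EdgeSet n m → Fin m → Set
    Free M j = ∀ i → M i j ≡ false

    record PrefixMatching (t : ℕ) (M : EdgeSet n m) : Set where
      field
        matching : IsMatching M
        arrived  : ∀ i j → M i j ≡ true → toℕ i ℕ.< t
        covers   : ∀ i → toℕ i ℕ.< t → ∃ λ j → M i j ≡ true

      one-per-row : ∀ {i j j'} → M i j ≡ true → M i j' ≡ true → j ≡ j'
      one-per-row = proj₁ matching _ _ _

      one-per-column : ∀ {i i' j} → M i j ≡ true → M i' j ≡ true → i ≡ i'
      one-per-column = proj₂ matching _ _ _

    data BipartitePath : List (Vertex n m) → Set where
      LR   : ∀ a b → BipartitePath (inj₁ a ∷ inj₂ b ∷ [])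
      RL   : ∀ b a → BipartitePath (inj₂ b ∷ inj₁ a ∷ [])
      LRL  : ∀ a b c → BipartitePath (inj₁ a ∷ inj₂ b ∷ inj₁ c ∷ [])
      RLR  : ∀ b a c → BipartitePath (inj₂ b ∷ inj₁ a ∷ inj₂ c ∷ [])
      LRLR : ∀ a b c d → BipartitePath (inj₁ a ∷ inj₂ b ∷ inj₁ c ∷ inj₂ d ∷ [])
      RLRL : ∀ d c b a → BipartitePath (inj₂ d ∷ inj₁ c ∷ inj₂ b ∷ inj₁ a ∷ [])

    bipartitePath : ∀ P → All IsEdge (pairs P) → 2 ℕ.≤ length P → length P ℕ.≤ 4 → BipartitePath P
    bipartitePath (_ ∷ []) _ (s≤s ()) _
    bipartitePath (inj₁ _ ∷ inj₁ _ ∷ _) (() ∷ _) _ _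
    bipartitePath (inj₂ _ ∷ inj₂ _ ∷ _) (() ∷ _) _ _
    bipartitePath (inj₁ a ∷ inj₂ b ∷ []) _ _ _ = LR a b
    bipartitePath (inj₂ b ∷ inj₁ a ∷ []) _ _ _ = RL b a
    bipartitePath (inj₁ _ ∷ inj₂ _ ∷ inj₂ _ ∷ _) (_ ∷ () ∷ _) _ _
    bipartitePath (inj₂ _ ∷ inj₁ _ ∷ inj₁ _ ∷ _) (_ ∷ () ∷ _) _ _
    bipartitePath (inj₁ a ∷ inj₂ b ∷ inj₁ c ∷ []) _ _ _ = LRL a b c
    bipartitePath (inj₂ b ∷ inj₁ a ∷ inj₂ c ∷ []) _ _ _ = RLR b a c
    bipartitePath (inj₁ _ ∷ inj₂ _ ∷ inj₁ _ ∷ inj₁ _ ∷ _) (_ ∷ _ ∷ () ∷ _) _ _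
    bipartitePath (inj₂ _ ∷ inj₁ _ ∷ inj₂ _ ∷ inj₂ _ ∷ _) (_ ∷ _ ∷ () ∷ _) _ _
    bipartitePath (inj₁ a ∷ inj₂ b ∷ inj₁ c ∷ inj₂ d ∷ []) _ _ _ = LRLR a b c d
    bipartitePath (inj₂ d ∷ inj₁ c ∷ inj₂ b ∷ inj₁ a ∷ []) _ _ _ = RLRL d c b a
    bipartitePath (_ ∷ _ ∷ _ ∷ _ ∷ _ ∷ _) _ _ (s≤s (s≤s (s≤s (s≤s ()))))

  module Arrival {n m t} (t<n : t ℕ.< n) {M : EdgeSet n m} (pm : PrefixMatching t M) where

    open PrefixMatching pm

    u : Fin n
    u = fromℕ< t<n

    toℕ-u : toℕ u ≡ t
    toℕ-u = toℕ-fromℕ< t<n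

    u<1+t : toℕ u ℕ.< suc t
    u<1+t = subst (ℕ._< suc t) (sym toℕ-u) (ℕ.n<1+n t)

    matched-≢u : ∀ {i j} → M i j ≡ true → i ≢ u
    matched-≢u {j = j} Muj refl = ℕ.<-irrefl toℕ-u (arrived u j Muj)

    u-unmatched : ∀ j → M u j ≡ false
    u-unmatched j = Bool.¬-not (λ Muj → matched-≢u Muj refl)

    matched-≢free : ∀ {l r r'} → M l r ≡ true → Free M r' → r ≢ r'
    matched-≢free {l} Mlr free-r' refl = true≢false (trans (sym Mlr) (free-r' l))

    arrived-or-u : ∀ i → toℕ i ℕ.< suc t → toℕ i ℕ.< t ⊎ i ≡ u
    arrived-or-u i i<1+t with toℕ i ℕ.<? t
    ... | yes i<t = inj₁ i<t
    ... | no  i≮t = inj₂ (toℕ-injective (trans (ℕ.≤∧≮⇒≡ (ℕ.m<1+n⇒m≤n i<1+t) i≮t) (sym toℕ-u)))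

    uncovered-left : ∀ a → toℕ a ℕ.≤ t → ¬ Covered M (inj₁ a) → a ≡ u
    uncovered-left a a≤t uncovered with arrived-or-u a (s≤s a≤t)
    ... | inj₁ a<t = ⊥-elim (uncovered (covers a a<t))
    ... | inj₂ a≡u = a≡u

    uncovered-right : ∀ b → ¬ Covered M (inj₂ b) → Free M b
    uncovered-right b uncovered i = Bool.¬-not (λ Mib → uncovered (i , Mib))

    not-all-covered : n ℕ.≤ m → ¬ (∀ j → ∃ λ i → M i j ≡ true)
    not-all-covered n≤m partner with pigeonhole (ℕ.<-≤-trans t<n n≤m) rank
      where
      rank : Fin m → Fin t
      rank j = fromℕ< (arrived _ j (proj₂ (partner j)))
    ... | j₁ , j₂ , j₁<j₂ , same-rank = ℕ.<-irrefl (cong toℕ j₁≡j₂) j₁<j₂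
      where
      same-partner : proj₁ (partner j₁) ≡ proj₁ (partner j₂)
      same-partner = toℕ-injective (trans (sym (toℕ-fromℕ< _)) (trans (cong toℕ same-rank) (toℕ-fromℕ< _)))
      j₁≡j₂ : j₁ ≡ j₂
      j₁≡j₂ = one-per-row (proj₂ (partner j₁)) (subst (λ i → M i j₂ ≡ true) (sym same-partner) (proj₂ (partner j₂)))

    ∃-free : n ℕ.≤ m → ∃ (Free M)
    ∃-free n≤m with any? (λ j → all? (λ i → M i j Bool.≟ false))
    ... | yes free = free
    ... | no  none = ⊥-elim (not-all-covered n≤m partner)
      where
      partner : ∀ j → ∃ λ i → M i j ≡ true
      partner j with any? (λ i → M i j Bool.≟ true)
      ... | yes p = p
      ... | no  q = ⊥-elim (none (j , λ i → Bool.¬-not (λ Mij → q (i , Mij))))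

    directPath : Fin m → List (Vertex n m)
    directPath r = inj₁ u ∷ inj₂ r ∷ []

    reroutePath : Fin m → Fin n → Fin m → List (Vertex n m)
    reroutePath r l r' = inj₁ u ∷ inj₂ r ∷ inj₁ l ∷ inj₂ r' ∷ []

    directPath-augmenting : ∀ {r} → Free M r → AugPath 4 t t<n M (directPath r)
    directPath-augmenting {r} free-r = record
      { inGraph       = ℕ.≤-reflexive toℕ-u ∷ tt ∷ []
      ; distinct      = ((λ ()) ∷ []) ∷ [] ∷ []
      ; atLeastTwo    = s≤s (s≤s z≤n)
      ; edges         = tt ∷ []
      ; alternating   = []
      ; endpointsFree = λ { _ (inj₁ refl) (j , Muj) → matched-≢u Muj refl
                          ; _ (inj₂ refl) (i , Mir) → true≢false (trans (sym Mir) (free-r i)) }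
      ; containsU     = here refl
      ; short         = s≤s (s≤s z≤n)
      }

    reroutePath-augmenting : ∀ {r l r'} → M l r ≡ true → Free M r' → AugPath 4 t t<n M (reroutePath r l r')
    reroutePath-augmenting {r} {l} {r'} Mlr free-r' = record
      { inGraph       = ℕ.≤-reflexive toℕ-u ∷ tt ∷ ℕ.<⇒≤ (arrived l r Mlr) ∷ tt ∷ []
      ; distinct      = ((λ ()) ∷ (λ { refl → matched-≢u Mlr refl }) ∷ (λ ()) ∷ [])
                      ∷ ((λ ()) ∷ (λ { refl → matched-≢free Mlr free-r' refl }) ∷ [])
                      ∷ ((λ ()) ∷ []) ∷ [] ∷ []
      ; atLeastTwo    = s≤s (s≤s z≤n)
      ; edges         = tt ∷ tt ∷ tt ∷ []
      ; alternating   = (λ Mur≡Mlr → true≢false (trans (sym Mlr) (trans (sym Mur≡Mlr) (u-unmatched r))))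
                      ∷ (λ Mlr≡Mlr' → true≢false (trans (sym Mlr) (trans Mlr≡Mlr' (free-r' l)))) ∷ []
      ; endpointsFree = λ { _ (inj₁ refl) (j , Muj) → matched-≢u Muj refl
                          ; _ (inj₂ refl) (i , Mir') → true≢false (trans (sym Mir') (free-r' i)) }
      ; containsU     = here refl
      ; short         = s≤s (s≤s (s≤s (s≤s z≤n)))
      }

    data Shape (P : List (Vertex n m)) : Set where
      direct  : ∀ r → Free M r → pathEdges P ≐ edgesOf ((u , r) ∷ []) → Shape P
      reroute : ∀ r l r' → M l r ≡ true → Free M r' →
                pathEdges P ≐ edgesOf ((u , r) ∷ (l , r) ∷ (l , r') ∷ []) → Shape P

    -- u is the only free arrived left vertex, so it is an endpoint; paths with three vertices are impossible
    shape-of : ∀ {P} → AugPath 4 t t<n M P → BipartitePath P → Shape P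
    shape-of ap (LR a b) with uncovered-left a (All.head (AugPath.inGraph ap)) (AugPath.endpointsFree ap _ (inj₁ refl))
    ... | refl = direct b (uncovered-right b (AugPath.endpointsFree ap _ (inj₂ refl))) (λ _ _ → refl)
    shape-of ap (RL b a) with uncovered-left a (All.head (All.tail (AugPath.inGraph ap))) (AugPath.endpointsFree ap _ (inj₂ refl))
    ... | refl = direct b (uncovered-right b (AugPath.endpointsFree ap _ (inj₁ refl))) (λ _ _ → refl)
    shape-of ap (LRL a b c)
      with uncovered-left a (All.head (AugPath.inGraph ap)) (AugPath.endpointsFree ap _ (inj₁ refl))
         | uncovered-left c (All.head (All.tail (All.tail (AugPath.inGraph ap)))) (AugPath.endpointsFree ap _ (inj₂ refl))
         | AugPath.distinct ap
    ... | refl | refl | (_ ∷ a≢c ∷ []) ∷ _ = ⊥-elim (a≢c refl)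
    shape-of ap (RLR b a c) with AugPath.containsU ap
    ... | there (here refl) = ⊥-elim (matched-≢u (proj₂ u-covered) refl)
      where
      u-covered : ∃ λ j → M u j ≡ true
      u-covered with M u b in Mub
      ... | true  = b , Mub
      ... | false = c , Bool.¬-not (λ Muc≡false → All.head (AugPath.alternating ap) (trans Mub (sym Muc≡false)))
    ... | there (there (here ()))
    ... | there (there (there ()))
    shape-of ap (LRLR a b c d) with uncovered-left a (All.head (AugPath.inGraph ap)) (AugPath.endpointsFree ap _ (inj₁ refl))
    ... | refl = reroute b c d Mcb (uncovered-right d (AugPath.endpointsFree ap _ (inj₂ refl))) (λ _ _ → refl)
      where
      Mcb : M c b ≡ true
      Mcb = Bool.¬-not (λ Mcb≡false → All.head (AugPath.alternating ap) (trans (u-unmatched b) (sym Mcb≡false)))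
    shape-of ap (RLRL d c b a)
      with uncovered-left a (All.lookup (AugPath.inGraph ap) (there (there (there (here refl))))) (AugPath.endpointsFree ap _ (inj₂ refl))
    ... | refl = reroute b c d Mcb (uncovered-right d (AugPath.endpointsFree ap _ (inj₁ refl)))
                   (edgesOf-reverse ((u , b) ∷ (c , b) ∷ (c , d) ∷ []))
      where
      Mcb : M c b ≡ true
      Mcb = Bool.¬-not (λ Mcb≡false → All.head (All.tail (AugPath.alternating ap)) (trans Mcb≡false (sym (u-unmatched b))))

    shape : ∀ {P} → AugPath 4 t t<n M P → Shape P
    shape {P} ap = shape-of ap (bipartitePath P (AugPath.edges ap) (AugPath.atLeastTwo ap) (AugPath.short ap))

    module Direct {r} (free-r : Free M r) {E} (E≐ : E ≐ edgesOf ((u , r) ∷ [])) where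

      open Toggle {M = M} {es = (u , r) ∷ []} E≐

      M' : EdgeSet n m
      M' = M △ E

      edge' : ∀ {i j} → M' i j ≡ true → M i j ≡ true ⊎ (i , j) ≡ (u , r)
      edge' M'ij with toggled M'ij
      ... | inj₁ (Mij , _)          = inj₁ Mij
      ... | inj₂ (_ , here ij≡ur)   = inj₂ ij≡ur
      ... | inj₂ (_ , there ())

      keep : ∀ {i j} → M i j ≡ true → M' i j ≡ true
      keep Mij = kept Mij λ { (here refl) → matched-≢u Mij refl ; (there ()) }

      new : M' u r ≡ true
      new = added (u-unmatched r) (here refl)

      free⁻ : ∀ j → Free M' j → Free M j
      free⁻ j free' i = Bool.¬-not (λ Mij → true≢false (trans (sym (keep Mij)) (free' i)))

      row' : ∀ i j j' → M' i j ≡ true → M' i j' ≡ true → j ≡ j'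
      row' i j j' M'ij M'ij' with edge' M'ij | edge' M'ij'
      ... | inj₁ Mij  | inj₁ Mij' = one-per-row Mij Mij'
      ... | inj₁ Muj  | inj₂ refl = ⊥-elim (matched-≢u Muj refl)
      ... | inj₂ refl | inj₁ Muj' = ⊥-elim (matched-≢u Muj' refl)
      ... | inj₂ refl | inj₂ refl = refl

      column' : ∀ i i' j → M' i j ≡ true → M' i' j ≡ true → i ≡ i'
      column' i i' j M'ij M'i'j with edge' M'ij | edge' M'i'j
      ... | inj₁ Mij  | inj₁ Mi'j = one-per-column Mij Mi'j
      ... | inj₁ Mir  | inj₂ refl = ⊥-elim (true≢false (trans (sym Mir) (free-r i)))
      ... | inj₂ refl | inj₁ Mi'r = ⊥-elim (true≢false (trans (sym Mi'r) (free-r i')))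
      ... | inj₂ refl | inj₂ refl = refl

      arrived' : ∀ i j → M' i j ≡ true → toℕ i ℕ.< suc t
      arrived' i j M'ij with edge' M'ij
      ... | inj₁ Mij  = ℕ.m<n⇒m<1+n (arrived i j Mij)
      ... | inj₂ refl = u<1+t

      covers' : ∀ i → toℕ i ℕ.< suc t → ∃ λ j → M' i j ≡ true
      covers' i i<1+t with arrived-or-u i i<1+t
      ... | inj₁ i<t  = proj₁ (covers i i<t) , keep (proj₂ (covers i i<t))
      ... | inj₂ refl = r , new

      prefixMatching' : PrefixMatching (suc t) M'
      prefixMatching' = record
        { matching = row' , column'
        ; arrived  = arrived'
        ; covers   = covers'
        }

    module Reroute {r l r'} (Mlr : M l r ≡ true) (free-r' : Free M r') {E}
                   (E≐ : E ≐ edgesOf ((u , r) ∷ (l , r) ∷ (l , r') ∷ [])) where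

      open Toggle {M = M} {es = (u , r) ∷ (l , r) ∷ (l , r') ∷ []} E≐

      M' : EdgeSet n m
      M' = M △ E

      u≢l : u ≢ l
      u≢l = matched-≢u Mlr ∘ sym

      r≢r' : r ≢ r'
      r≢r' = matched-≢free Mlr free-r'

      edge' : ∀ {i j} → M' i j ≡ true → (M i j ≡ true × (i , j) ≢ (l , r)) ⊎ ((i , j) ≡ (u , r) ⊎ (i , j) ≡ (l , r'))
      edge' M'ij with toggled M'ij
      ... | inj₁ (Mij , ij∉es)                    = inj₁ (Mij , λ ij≡lr → ij∉es (there (here ij≡lr)))
      ... | inj₂ (_ , here ij≡ur)                 = inj₂ (inj₁ ij≡ur)
      ... | inj₂ (Mlr≡false , there (here refl))  = ⊥-elim (true≢false (trans (sym Mlr) Mlr≡false))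
      ... | inj₂ (_ , there (there (here ij≡lr'))) = inj₂ (inj₂ ij≡lr')
      ... | inj₂ (_ , there (there (there ())))

      keep : ∀ {i j} → M i j ≡ true → (i , j) ≢ (l , r) → M' i j ≡ true
      keep Mij ij≢lr = kept Mij λ
        { (here refl)                → matched-≢u Mij refl
        ; (there (here ij≡lr))       → ij≢lr ij≡lr
        ; (there (there (here refl))) → true≢false (trans (sym Mij) (free-r' _))
        ; (there (there (there ())))
        }

      new-ur : M' u r ≡ true
      new-ur = added (u-unmatched r) (here refl)

      new-lr' : M' l r' ≡ true
      new-lr' = added (free-r' l) (there (there (here refl)))

      free⁻ : ∀ j → Free M' j → Free M j
      free⁻ j free' i with M i j in Mij | ≡-dec _≟_ _≟_ (i , j) (l , r)
      ... | false | _        = refl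
      ... | true  | yes refl = ⊥-elim (true≢false (trans (sym new-ur) (free' u)))
      ... | true  | no ij≢lr = ⊥-elim (true≢false (trans (sym (keep Mij ij≢lr)) (free' i)))

      row' : ∀ i j j' → M' i j ≡ true → M' i j' ≡ true → j ≡ j'
      row' i j j' M'ij M'ij' with edge' M'ij | edge' M'ij'
      ... | inj₁ (Mij , _)     | inj₁ (Mij' , _)     = one-per-row Mij Mij'
      ... | inj₁ (Muj , _)     | inj₂ (inj₁ refl)    = ⊥-elim (matched-≢u Muj refl)
      ... | inj₁ (Mlj , lj≢lr) | inj₂ (inj₂ refl)    = ⊥-elim (lj≢lr (cong (l ,_) (one-per-row Mlj Mlr)))
      ... | inj₂ (inj₁ refl)   | inj₁ (Muj' , _)     = ⊥-elim (matched-≢u Muj' refl)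
      ... | inj₂ (inj₂ refl)   | inj₁ (Mlj' , lj'≢lr) = ⊥-elim (lj'≢lr (cong (l ,_) (one-per-row Mlj' Mlr)))
      ... | inj₂ (inj₁ refl)   | inj₂ (inj₁ refl)    = refl
      ... | inj₂ (inj₂ refl)   | inj₂ (inj₂ refl)    = refl
      ... | inj₂ (inj₁ refl)   | inj₂ (inj₂ u≡l)     = ⊥-elim (u≢l (cong proj₁ u≡l))
      ... | inj₂ (inj₂ uj≡lr')  | inj₂ (inj₁ refl)    = ⊥-elim (u≢l (cong proj₁ uj≡lr'))

      column' : ∀ i i' j → M' i j ≡ true → M' i' j ≡ true → i ≡ i'
      column' i i' j M'ij M'i'j with edge' M'ij | edge' M'i'j
      ... | inj₁ (Mij , _)     | inj₁ (Mi'j , _)      = one-per-column Mij Mi'j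
      ... | inj₁ (Mir , ir≢lr) | inj₂ (inj₁ refl)     = ⊥-elim (ir≢lr (cong (_, r) (one-per-column Mir Mlr)))
      ... | inj₁ (Mir' , _)    | inj₂ (inj₂ refl)     = ⊥-elim (true≢false (trans (sym Mir') (free-r' i)))
      ... | inj₂ (inj₁ refl)   | inj₁ (Mi'r , i'r≢lr) = ⊥-elim (i'r≢lr (cong (_, r) (one-per-column Mi'r Mlr)))
      ... | inj₂ (inj₂ refl)   | inj₁ (Mi'r' , _)     = ⊥-elim (true≢false (trans (sym Mi'r') (free-r' i')))
      ... | inj₂ (inj₁ refl)   | inj₂ (inj₁ refl)     = refl
      ... | inj₂ (inj₂ refl)   | inj₂ (inj₂ refl)     = refl
      ... | inj₂ (inj₁ refl)   | inj₂ (inj₂ r≡r')     = ⊥-elim (r≢r' (cong proj₂ r≡r'))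
      ... | inj₂ (inj₂ ir≡lr') | inj₂ (inj₁ refl)     = ⊥-elim (r≢r' (cong proj₂ ir≡lr'))

      arrived' : ∀ i j → M' i j ≡ true → toℕ i ℕ.< suc t
      arrived' i j M'ij with edge' M'ij
      ... | inj₁ (Mij , _)   = ℕ.m<n⇒m<1+n (arrived i j Mij)
      ... | inj₂ (inj₁ refl) = u<1+t
      ... | inj₂ (inj₂ refl) = ℕ.m<n⇒m<1+n (arrived l r Mlr)

      covers' : ∀ i → toℕ i ℕ.< suc t → ∃ λ j → M' i j ≡ true
      covers' i i<1+t with arrived-or-u i i<1+t
      ... | inj₂ refl = r , new-ur
      ... | inj₁ i<t with covers i i<t
      ...   | j , Mij with ≡-dec _≟_ _≟_ (i , j) (l , r)
      ...     | yes refl   = r' , new-lr'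
      ...     | no ij≢lr   = j , keep Mij ij≢lr

      prefixMatching' : PrefixMatching (suc t) M'
      prefixMatching' = record
        { matching = row' , column'
        ; arrived  = arrived'
        ; covers   = covers'
        }

  -- The charging argument

  module Charging {n m} (w : Weights n m) (w≥0 : ∀ i j → 0ℚ ≤ w i j)
                  (N : EdgeSet n m) (N-lpm : IsLeftPerfectMatching N) where

    ν : Fin n → Fin m
    ν i = proj₁ (proj₂ N-lpm i)

    N-ν : ∀ i → N i (ν i) ≡ true
    N-ν i = proj₂ (proj₂ N-lpm i)

    N-row : ∀ i (f : Fin m → ℚ) → sumFin m (λ j → if N i j then f j else 0ℚ) ≡ f (ν i)
    N-row i f = sumFin-indicator m (N i) f (N-ν i) (λ j Nij → proj₁ (proj₁ N-lpm) i j (ν i) Nij (N-ν i))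

    ν-injective : ∀ {i i'} → ν i ≡ ν i' → i ≡ i'
    ν-injective {i} {i'} νi≡νi' = proj₂ (proj₁ N-lpm) i i' (ν i') (subst (λ j → N i j ≡ true) νi≡νi' (N-ν i)) (N-ν i')

    record DualFeasible (M : EdgeSet n m) (H : Fin m → ℚ) : Set where
      field
        nonpos-free       : ∀ j → Free M j → H j ≤ 0ℚ
        ≤-matched         : ∀ {i j} → M i j ≡ true → H j ≤ w i j
        ≤-matched-vs-free : ∀ {i j} j' → M i j ≡ true → Free M j' → H j ≤ w i j - w i j'

    record Invariant (t : ℕ) (M : EdgeSet n m) : Set where
      field
        prefixMatching : PrefixMatching t M
        H              : Fin m → ℚ
        dualFeasible   : DualFeasible M H
        charged        : arrivedSum t (λ i → w i (ν i)) ≤ weight w M + arrivedSum t (H ∘ ν)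

    initial : Invariant 0 emptyM
    initial = record
      { prefixMatching = record { matching = (λ _ _ _ ()) , (λ _ _ _ ()) ; arrived = λ _ _ () ; covers = λ _ () }
      ; H              = const 0ℚ
      ; dualFeasible   = record { nonpos-free = λ _ _ → ℚ.≤-refl ; ≤-matched = λ () ; ≤-matched-vs-free = λ _ () }
      ; charged        = subst₂ _≤_ (sym (arrivedSum-zero (λ i → w i (ν i)))) (sym nothing-charged) ℚ.≤-refl
      }
      where
      nothing-charged : weight w emptyM + arrivedSum 0 (const 0ℚ ∘ ν) ≡ 0ℚ
      nothing-charged = trans (cong₂ _+_ (sumOver-[] w) (arrivedSum-zero (const 0ℚ ∘ ν))) (ℚ.+-identityˡ 0ℚ)

    dual-total : ∀ {M H} → IsMatching M → DualFeasible M H → sumFin n (H ∘ ν) ≤ weight w M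
    dual-total {M} {H} M-matching feasible = begin
      sumFin n (H ∘ ν)                                             ≡⟨ sumFin-cong n (λ i → N-row i H) ⟨
      sumFin n (λ i → sumFin m (λ j → if N i j then H j else 0ℚ)) ≡⟨ sumFin-comm n m _ ⟩
      sumFin m (λ j → sumFin n (λ i → if N i j then H j else 0ℚ)) ≤⟨ sumFin-mono m column ⟩
      sumFin m columnWeight                                        ≡⟨ sumFin-comm n m _ ⟨
      weight w M                                                   ∎
      where
      open ℚ.≤-Reasoning
      open DualFeasible feasible
      columnWeight : Fin m → ℚ
      columnWeight j = sumFin n (λ i → if M i j then w i j else 0ℚ)
      columnWeight-nonneg : ∀ j → 0ℚ ≤ columnWeight j
      columnWeight-nonneg j = sumFin-nonneg n nonneg
        where
        nonneg : ∀ i → 0ℚ ≤ (if M i j then w i j else 0ℚ)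
        nonneg i with M i j
        ... | true  = w≥0 i j
        ... | false = ℚ.≤-refl
      H≤columnWeight : ∀ j → H j ≤ columnWeight j
      H≤columnWeight j with any? (λ i → M i j Bool.≟ true)
      ... | yes (i , Mij) = subst (H j ≤_)
              (sym (sumFin-indicator n (λ i → M i j) (λ i → w i j) Mij (λ i' Mi'j → proj₂ M-matching i' i j Mi'j Mij)))
              (≤-matched Mij)
      ... | no unmatched = ℚ.≤-trans (nonpos-free j (λ i → Bool.¬-not (λ Mij → unmatched (i , Mij)))) (columnWeight-nonneg j)
      column : ∀ j → sumFin n (λ i → if N i j then H j else 0ℚ) ≤ columnWeight j
      column j = sumFin-atMostOnce-≤ n (λ i → N i j) (λ i i' → proj₂ (proj₁ N-lpm) i i' j)
                   (H≤columnWeight j) (columnWeight-nonneg j)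

    optimum≤twice : ∀ {M} → Invariant n M → weight w N ≤ weight w M + weight w M
    optimum≤twice {M} I = begin
      weight w N                         ≡⟨ sumFin-cong n (λ i → N-row i (w i)) ⟩
      sumFin n (λ i → w i (ν i))         ≡⟨ arrivedSum-all (λ i → w i (ν i)) ⟨
      arrivedSum n (λ i → w i (ν i))     ≤⟨ charged ⟩
      weight w M + arrivedSum n (H ∘ ν)  ≡⟨ cong (weight w M +_) (arrivedSum-all (H ∘ ν)) ⟩
      weight w M + sumFin n (H ∘ ν)      ≤⟨ ℚ.+-monoʳ-≤ (weight w M) (dual-total (PrefixMatching.matching prefixMatching) dualFeasible) ⟩
      weight w M + weight w M            ∎
      where
      open ℚ.≤-Reasoning
      open Invariant I

    module Augment {t} (t<n : t ℕ.< n) {M} (I : Invariant t M) {P} (ap : AugPath 4 t t<n M P)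
                   (optimal : ∀ Q → AugPath 4 t t<n M Q → gain w M Q ≤ gain w M P) where

      open Invariant I
      open DualFeasible dualFeasible
      open Arrival t<n prefixMatching

      g : ℚ
      g = gain w M P

      sumOver-direct : ∀ r → sumOver (edgesOf ((u , r) ∷ [])) (toggleGain w M) ≡ w u r
      sumOver-direct r = begin
        sumOver (edgesOf ((u , r) ∷ [])) (toggleGain w M)           ≡⟨ sumOver-∷ (toggleGain w M) {es = []} (λ ()) ⟩
        toggleGain w M u r + sumOver (edgesOf []) (toggleGain w M) ≡⟨ cong₂ _+_ (cong (λ b → if b then - w u r else w u r) (u-unmatched r)) (sumOver-[] (toggleGain w M)) ⟩
        w u r + 0ℚ                                                 ≡⟨ ℚ.+-identityʳ (w u r) ⟩
        w u r                                                      ∎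
        where open ≡-Reasoning

      sumOver-reroute : ∀ {r l r'} → M l r ≡ true → Free M r' →
        sumOver (edgesOf ((u , r) ∷ (l , r) ∷ (l , r') ∷ [])) (toggleGain w M) ≡ w u r - w l r + w l r'
      sumOver-reroute {r} {l} {r'} Mlr free-r' = begin
        sumOver (edgesOf ((u , r) ∷ (l , r) ∷ (l , r') ∷ [])) G
          ≡⟨ sumOver-∷ G ur∉ ⟩
        G u r + sumOver (edgesOf ((l , r) ∷ (l , r') ∷ [])) G
          ≡⟨ cong (G u r +_) (trans (sumOver-∷ G lr∉) (cong (G l r +_) (sumOver-∷ G {es = []} (λ ())))) ⟩
        G u r + (G l r + (G l r' + sumOver (edgesOf []) G))
          ≡⟨ cong₂ (λ x y → x + (y + (G l r' + sumOver (edgesOf []) G))) (cong (λ b → if b then - w u r else w u r) (u-unmatched r)) (cong (λ b → if b then - w l r else w l r) Mlr) ⟩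
        w u r + (- w l r + (G l r' + sumOver (edgesOf []) G))
          ≡⟨ cong (λ x → w u r + (- w l r + x)) (trans (cong₂ _+_ (cong (λ b → if b then - w l r' else w l r') (free-r' l)) (sumOver-[] G)) (ℚ.+-identityʳ (w l r'))) ⟩
        w u r + (- w l r + w l r')
          ≡⟨ p+[-q+r]≡p-q+r (w u r) (w l r) (w l r') ⟩
        w u r - w l r + w l r' ∎
        where
        open ≡-Reasoning
        G = toggleGain w M
        ur∉ : (u , r) ∉ (l , r) ∷ (l , r') ∷ []
        ur∉ (here ur≡lr)          = matched-≢u Mlr (sym (cong proj₁ ur≡lr))
        ur∉ (there (here ur≡lr')) = matched-≢u Mlr (sym (cong proj₁ ur≡lr'))
        lr∉ : (l , r) ∉ (l , r') ∷ []
        lr∉ (here lr≡lr') = matched-≢free Mlr free-r' (cong proj₂ lr≡lr')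

      direct-bound : ∀ j → Free M j → w u j ≤ g
      direct-bound j free-j =
        subst (_≤ g) (trans (gain≡sumOver w M (directPath j)) (sumOver-direct j)) (optimal _ (directPath-augmenting free-j))

      reroute-bound : ∀ {i j} j' → M i j ≡ true → Free M j' → w u j - w i j + w i j' ≤ g
      reroute-bound {i} {j} j' Mij free-j' =
        subst (_≤ g) (trans (gain≡sumOver w M (reroutePath j i j')) (sumOver-reroute Mij free-j'))
          (optimal _ (reroutePath-augmenting Mij free-j'))

      g≥0 : ∃ (Free M) → 0ℚ ≤ g
      g≥0 (j , free-j) = ℚ.≤-trans (w≥0 u j) (direct-bound j free-j)

      -- lowering the dual at ν u makes the charge w u (ν u) - H' (ν u) of u exactly the gain
      H' : Fin m → ℚ
      H' = updateAt H (ν u) (const (w u (ν u) - g))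

      H'-bound : ∀ j {x} → (j ≡ ν u → w u (ν u) - g ≤ x) → (j ≢ ν u → H j ≤ x) → H' j ≤ x
      H'-bound j at-νu elsewhere with j ≟ ν u
      ... | yes refl = subst (_≤ _) (sym (updateAt-updates (ν u) H)) (at-νu refl)
      ... | no j≢νu  = subst (_≤ _) (sym (updateAt-minimal j (ν u) H j≢νu)) (elsewhere j≢νu)

      H'-free : ∀ j → Free M j → H' j ≤ 0ℚ
      H'-free j free-j = H'-bound j (λ { refl → p≤q⇒p-q≤0 (direct-bound j free-j) }) (λ _ → nonpos-free j free-j)

      matched-slack : ∀ {i j} j' → M i j ≡ true → Free M j' → w u j - g ≤ w i j - w i j'
      matched-slack {i} {j} j' Mij free-j' = p-q+r≤s⇒p-s≤q-r {w u j} {w i j} {w i j'} {g} (reroute-bound j' Mij free-j')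

      H'-matched : ∃ (Free M) → ∀ {i j} → M i j ≡ true → H' j ≤ w i j
      H'-matched (f , free-f) {i} {j} Mij = H'-bound j
        (λ { refl → ℚ.≤-trans (matched-slack f Mij free-f) (0≤q⇒p-q≤p {w i j} (w≥0 i f)) })
        (λ _ → ≤-matched Mij)

      H'-matched-vs-free : ∀ {i j} j' → M i j ≡ true → Free M j' → H' j ≤ w i j - w i j'
      H'-matched-vs-free {j = j} j' Mij free-j' = H'-bound j
        (λ { refl → matched-slack j' Mij free-j' })
        (λ _ → ≤-matched-vs-free j' Mij free-j')

      H'-new : ∀ {r} → ∃ (Free M) → H' r ≤ w u r - g → H' r ≤ w u r × (∀ j' → Free M j' → H' r ≤ w u r - w u j')
      H'-new {r} free H'r≤ = ℚ.≤-trans H'r≤ (0≤q⇒p-q≤p {w u r} (g≥0 free)) ,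
                             λ j' free-j' → ℚ.≤-trans H'r≤ (r≤q⇒p-q≤p-r {w u r} (direct-bound j' free-j'))

      charged' : arrivedSum (suc t) (λ i → w i (ν i)) ≤ weight w (M △ pathEdges P) + arrivedSum (suc t) (H' ∘ ν)
      charged' = subst₂ _≤_ (sym (arrivedSum-suc t<n (λ i → w i (ν i)))) (sym charges) (ℚ.+-monoˡ-≤ (w u (ν u)) charged)
        where
        open ≡-Reasoning
        H'-old : ∀ i → toℕ i ℕ.< t → H' (ν i) ≡ H (ν i)
        H'-old i i<t = updateAt-minimal (ν i) (ν u) H
          (λ νi≡νu → ℕ.<-irrefl toℕ-u (subst (λ k → toℕ k ℕ.< t) (ν-injective νi≡νu) i<t))
        charges : weight w (M △ pathEdges P) + arrivedSum (suc t) (H' ∘ ν) ≡ weight w M + arrivedSum t (H ∘ ν) + w u (ν u)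
        charges = begin
          weight w (M △ pathEdges P) + arrivedSum (suc t) (H' ∘ ν)
            ≡⟨ cong₂ _+_ (q≡p+[q-p] (weight w M) (weight w (M △ pathEdges P))) (arrivedSum-suc t<n (H' ∘ ν)) ⟩
          weight w M + g + (arrivedSum t (H' ∘ ν) + H' (ν u))
            ≡⟨ cong₂ (λ a b → weight w M + g + (a + b)) (arrivedSum-cong t H'-old) (updateAt-updates (ν u) H) ⟩
          weight w M + g + (arrivedSum t (H ∘ ν) + (w u (ν u) - g))
            ≡⟨ p+q+[r+[s-q]]≡p+r+s (weight w M) g (arrivedSum t (H ∘ ν)) (w u (ν u)) ⟩
          weight w M + arrivedSum t (H ∘ ν) + w u (ν u) ∎

      module DirectCase {r} (free-r : Free M r) (E≐ : pathEdges P ≐ edgesOf ((u , r) ∷ [])) where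

        open Direct free-r E≐

        g≡wur : g ≡ w u r
        g≡wur = trans (gain≡sumOver w M P) (trans (sumOver-cong (toggleGain w M) E≐) (sumOver-direct r))

        H'r≤ : H' r ≤ w u r - g
        H'r≤ = H'-bound r (λ { refl → ℚ.≤-refl })
          (λ _ → subst (H r ≤_) (sym (trans (cong (_-_ (w u r)) g≡wur) (ℚ.+-inverseʳ (w u r)))) (nonpos-free r free-r))

        new-edge : H' r ≤ w u r × (∀ j' → Free M j' → H' r ≤ w u r - w u j')
        new-edge = H'-new (r , free-r) H'r≤

        matched' : ∀ {i j} → M' i j ≡ true → H' j ≤ w i j
        matched' M'ij with edge' M'ij
        ... | inj₁ Mij  = H'-matched (r , free-r) Mij
        ... | inj₂ refl = proj₁ new-edge

        matched-vs-free' : ∀ {i j} j' → M' i j ≡ true → Free M' j' → H' j ≤ w i j - w i j'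
        matched-vs-free' j' M'ij free' with edge' M'ij
        ... | inj₁ Mij  = H'-matched-vs-free j' Mij (free⁻ j' free')
        ... | inj₂ refl = proj₂ new-edge j' (free⁻ j' free')

        invariant' : Invariant (suc t) M'
        invariant' = record
          { prefixMatching = prefixMatching'
          ; H              = H'
          ; dualFeasible   = record
            { nonpos-free = λ j → H'-free j ∘ free⁻ j ; ≤-matched = matched' ; ≤-matched-vs-free = matched-vs-free' }
          ; charged        = charged'
          }

      module RerouteCase {r l r'} (Mlr : M l r ≡ true) (free-r' : Free M r')
                         (E≐ : pathEdges P ≐ edgesOf ((u , r) ∷ (l , r) ∷ (l , r') ∷ [])) where

        open Reroute Mlr free-r' E≐

        g≡ : g ≡ w u r - w l r + w l r'
        g≡ = trans (gain≡sumOver w M P) (trans (sumOver-cong (toggleGain w M) E≐) (sumOver-reroute Mlr free-r'))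

        H'r≤ : H' r ≤ w u r - g
        H'r≤ = H'-bound r (λ { refl → ℚ.≤-refl })
          (λ _ → subst (H r ≤_) (trans (q-r≡p-[p-q+r] (w u r) (w l r) (w l r')) (cong (_-_ (w u r)) (sym g≡)))
                   (≤-matched-vs-free r' Mlr free-r'))

        new-edge : H' r ≤ w u r × (∀ j' → Free M j' → H' r ≤ w u r - w u j')
        new-edge = H'-new (r' , free-r') H'r≤

        H'r'≤0 : H' r' ≤ 0ℚ
        H'r'≤0 = H'-free r' free-r'

        matched' : ∀ {i j} → M' i j ≡ true → H' j ≤ w i j
        matched' M'ij with edge' M'ij
        ... | inj₁ (Mij , _)   = H'-matched (r' , free-r') Mij
        ... | inj₂ (inj₁ refl) = proj₁ new-edge
        ... | inj₂ (inj₂ refl) = ℚ.≤-trans H'r'≤0 (w≥0 l r')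

        matched-vs-free' : ∀ {i j} j' → M' i j ≡ true → Free M' j' → H' j ≤ w i j - w i j'
        matched-vs-free' j' M'ij free' with edge' M'ij
        ... | inj₁ (Mij , _)   = H'-matched-vs-free j' Mij (free⁻ j' free')
        ... | inj₂ (inj₁ refl) = proj₂ new-edge j' (free⁻ j' free')
        ... | inj₂ (inj₂ refl) = ℚ.≤-trans H'r'≤0 (p≤q⇒0≤q-p (p-q+r≤p-q+s⇒r≤s {w u r} {w l r}
                                   (subst (_ ≤_) g≡ (reroute-bound j' Mlr (free⁻ j' free')))))

        invariant' : Invariant (suc t) M'
        invariant' = record
          { prefixMatching = prefixMatching'
          ; H              = H'
          ; dualFeasible   = record
            { nonpos-free = λ j → H'-free j ∘ free⁻ j ; ≤-matched = matched' ; ≤-matched-vs-free = matched-vs-free' }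
          ; charged        = charged'
          }

      invariant' : Invariant (suc t) (M △ pathEdges P)
      invariant' with shape ap
      ... | direct r free-r E≐            = DirectCase.invariant' free-r E≐
      ... | reroute r l r' Mlr free-r' E≐ = RerouteCase.invariant' Mlr free-r' E≐

    invariant : n ℕ.≤ m → ∀ {t M} → Run 4 w t M → Invariant t M
    invariant n≤m start = initial
    invariant n≤m (augment t<n run P ap optimal) = Augment.invariant' t<n (invariant n≤m run) ap optimal
    invariant n≤m (idle t<n run no-path) = ⊥-elim (no-path _ (directPath-augmenting (proj₂ (∃-free n≤m))))
      where open Arrival t<n (Invariant.prefixMatching (invariant n≤m run))

  optimum≤twice-algorithm : ∀ {n m} → n ℕ.≤ m → (w : Weights n m) → (∀ i j → 0ℚ ≤ w i j) →
    ∀ {M} → Run 4 w n M → (N : EdgeSet n m) → IsLeftPerfectMatching N → weight w N ≤ weight w M + weight w M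
  optimum≤twice-algorithm n≤m w w≥0 run N N-lpm = optimum≤twice (invariant n≤m run)
    where open Charging w w≥0 N N-lpm

open import Data.Nat using (ℕ; _≤_)
open import Data.Product using (Σ; _×_; _,_)
open import Data.Rational using (ℚ; 0ℚ; ½; _*_; _-_)
import Data.Rational as Q
import Data.Rational.Properties as ℚ
open DualFitting using (optimum≤twice-algorithm)
open RationalArithmetic using (p≤q+q⇒½*p-0≤q)

theorem3 : Σ ℚ λ c → (0ℚ Q.≤ c) ×
    ((n m : ℕ) → n ≤ m → (w : Weights n m) → (∀ i j → 0ℚ Q.≤ w i j) →
     (M : EdgeSet n m) → Run 4 w n M →
     (N : EdgeSet n m) → IsLeftPerfectMatching N →
     ½ * weight w N - c Q.≤ weight w M)
theorem3 = 0ℚ , ℚ.≤-refl , λ n m n≤m w w≥0 M run N N-lpm →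
  p≤q+q⇒½*p-0≤q (optimum≤twice-algorithm n≤m w w≥0 run N N-lpm)
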